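{- Let $\phi=(1+\sqrt5)/2$ and for an integer $k\ge1$ define $$A(k,1)=\sum_{n=1}^{F_k-1}\lfloor\phi n\rfloor,\qquad A'(k,1)=\sum_{n=1}^{F_k-1}\lfloor\phi^2 n\rfloor.$$ Then for every integer $k\ge1$, $$\operatorname{LCM}\bigl(A(2k,1),A'(2k,1)\bigr)=\begin{cases}\dfrac12F_{k+1}F_kL_{k+2}L_{k+1}L_{k-1} & \text{if $k$ is even},\\[4.5pt] \dfrac12F_{k+2}F_{k+1}F_{k-1}L_{k+1}L_k & \text{if $k$ is odd}.\end{cases}$$
   Context: $\lfloor x\rfloor$ denotes the integer part of $x$; an empty sum is $0$. The Fibonacci numbers $F_n$ and Lucas numbers $L_n$ are defined by $F_0=0$, $F_1=1$, $L_0=2$, $L_1=1$ and $F_{n+2}=F_{n+1}+F_n$, $L_{n+2}=L_{n+1}+L_n$ for $n\ge0$. $\operatorname{LCM}$ denotes the least common multiple (with $\operatorname{LCM}(0,0)=0$). -}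

module Defs where

open import Data.Nat using (ℕ; zero; suc; _+_; _*_; _∸_; _^_; _≤ᵇ_)
open import Data.Bool using (Bool; true; false; _∨_; if_then_else_)

F : ℕ → ℕ
F 0 = 0
F 1 = 1
F (suc (suc n)) = F (suc n) + F n

L : ℕ → ℕ
L 0 = 2
L 1 = 1
L (suc (suc n)) = L (suc n) + L n

-- Exact test of  m ≤ (a + b√5)/2  for naturals a b m:
-- 2m ≤ a + b√5  ⇔  2m ≤ a  or  (2m - a)² ≤ 5b²
leHalfSqrt5 : ℕ → ℕ → ℕ → Bool
leHalfSqrt5 a b m = ((2 * m) ≤ᵇ a) ∨ (((2 * m ∸ a) ^ 2) ≤ᵇ (5 * b ^ 2))

count : ℕ → (ℕ → Bool) → ℕ
count zero p = 0
count (suc N) p = count N p + (if p (suc N) then 1 else 0)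

-- ⌊(a + b√5)/2⌋ = #{ m ≥ 1 : m ≤ (a + b√5)/2 }   (the value is ≥ 0, and
-- (a + b√5)/2 < a + 3b + 1, so searching m ∈ {1,…,a+3b+1} suffices)
floorHalfSqrt5 : ℕ → ℕ → ℕ
floorHalfSqrt5 a b = count (a + 3 * b + 1) (leHalfSqrt5 a b)

-- ⌊φ n⌋ with φ = (1+√5)/2, and ⌊φ² n⌋ with φ² = (3+√5)/2
floorPhi : ℕ → ℕ
floorPhi n = floorHalfSqrt5 n n

floorPhi2 : ℕ → ℕ
floorPhi2 n = floorHalfSqrt5 (3 * n) n

sumFrom1 : ℕ → (ℕ → ℕ) → ℕ
sumFrom1 zero f = 0
sumFrom1 (suc N) f = sumFrom1 N f + f (suc N)

A : ℕ → ℕ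
A k = sumFrom1 (F k ∸ 1) floorPhi

A' : ℕ → ℕ
A' k = sumFrom1 (F k ∸ 1) floorPhi2

-- Let x = F (2k) and y = F (2k + 1). Cassini gives y² = x y + x² + 1, so y / x is so close to φ that
-- ⌊φ n⌋ = ⌊n y / x⌋ and ⌊φ² n⌋ = n + ⌊φ n⌋ for 0 < n < x. Since x and y are coprime, x ∤ n y, so
-- ⌊n y / x⌋ + ⌊(x − n) y / x⌋ = y − 1 and pairing n with x − n gives 2A = (x − 1)(y − 1) and
-- 2A' = (x − 1)(x + y − 1). Cassini once more, now at index k − 2 or k − 1, factors x − 1, y − 1 and
-- x + y − 1 into Fibonacci and Lucas numbers, so that 2A = X p and 2A' = X q with p, q consecutive
-- Lucas (k even) or Fibonacci (k odd) numbers, hence coprime; then 2 ∣ X and lcm(A, A') = X p q / 2.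

module Submission where

open import Data.Bool using (Bool; true; false; T; if_then_else_)
open import Data.Bool.Properties using (T-∨)
open import Data.List.Base using (_∷_; [])
open import Data.Nat
open import Data.Nat.Coprimality as Coprimality using (Coprime; coprime-divisor; coprime-+; coprime⇒gcd≡1)
open import Data.Nat.Divisibility
open import Data.Nat.DivMod using (m≡m%n+[m/n]*n; m%n<n; m*n/n≡m; m*n%n≡0)
open import Data.Nat.GCD using (gcd; c*gcd[m,n]≡gcd[cm,cn])
open import Data.Nat.LCM using (lcm; gcd*lcm)
open import Data.Nat.Primality using (euclidsLemma; prime[2])
open import Data.Nat.Properties
open import Algebra.Properties.CommutativeSemigroup *-commutativeSemigroup using (interchange; x∙yz≈y∙xz)
open import Algebra.Properties.CommutativeSemigroup +-commutativeSemigroup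
  using () renaming (interchange to +-interchange)
open import Data.Nat.Tactic.RingSolver using (solve-∀; solve)
open import Data.Product using (_×_; _,_; proj₂)
open import Data.Sum using (_⊎_; inj₁; inj₂)
open import Function using (_∘_; id; _⇔_; mk⇔; Equivalence)
open import Relation.Binary.PropositionalEquality
open import Relation.Nullary using (¬_; contradiction)

open import Defs

open Equivalence using (to; from)

data LeHalfSqrt5 (a b m : ℕ) : Set where
  linear    : 2 * m ≤ a → LeHalfSqrt5 a b m
  quadratic : (2 * m ∸ a) * (2 * m ∸ a) ≤ 5 * (b * b) → LeHalfSqrt5 a b m

^2≡* : ∀ x → x ^ 2 ≡ x * x
^2≡* x = cong (x *_) (*-identityʳ x)

T-leHalfSqrt5 : ∀ a b m → T (leHalfSqrt5 a b m) ⇔ LeHalfSqrt5 a b m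
T-leHalfSqrt5 a b m = mk⇔ (fromSum ∘ to T-∨) (from T-∨ ∘ toSum)
  where
  d : ℕ
  d = 2 * m ∸ a
  fromSum : T (2 * m ≤ᵇ a) ⊎ T (d ^ 2 ≤ᵇ 5 * b ^ 2) → LeHalfSqrt5 a b m
  fromSum (inj₁ t) = linear (≤ᵇ⇒≤ (2 * m) a t)
  fromSum (inj₂ t) = quadratic (subst₂ _≤_ (^2≡* d) (cong (5 *_) (^2≡* b)) (≤ᵇ⇒≤ (d ^ 2) (5 * b ^ 2) t))
  toSum : LeHalfSqrt5 a b m → T (2 * m ≤ᵇ a) ⊎ T (d ^ 2 ≤ᵇ 5 * b ^ 2)
  toSum (linear le) = inj₁ (≤⇒≤ᵇ le)
  toSum (quadratic le) = inj₂ (≤⇒≤ᵇ (subst₂ _≤_ (sym (^2≡* d)) (cong (5 *_) (sym (^2≡* b))) le))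

m*m≤n*n⇒m≤n : ∀ {m n} → m * m ≤ n * n → m ≤ n
m*m≤n*n⇒m≤n mm≤nn = ≮⇒≥ (λ n<m → <⇒≱ (*-mono-< n<m n<m) mm≤nn)

LeHalfSqrt5-anti : ∀ {a b m m′} → m ≤ m′ → LeHalfSqrt5 a b m′ → LeHalfSqrt5 a b m
LeHalfSqrt5-anti m≤m′ (linear le) = linear (≤-trans (*-monoʳ-≤ 2 m≤m′) le)
LeHalfSqrt5-anti {a} {m = m} {m′} m≤m′ (quadratic le) = quadratic (≤-trans (*-mono-≤ d≤d′ d≤d′) le)
  where
  d≤d′ : 2 * m ∸ a ≤ 2 * m′ ∸ a
  d≤d′ = ∸-monoˡ-≤ a (*-monoʳ-≤ 2 m≤m′)

LeHalfSqrt5⇒≤ : ∀ {a b m} → LeHalfSqrt5 a b m → m ≤ a + 3 * b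
LeHalfSqrt5⇒≤ {a} {b} {m} le = ≤-trans (m≤m+n m (m + 0))
  (≤-trans (m≤n+m∸n (2 * m) a) (+-monoʳ-≤ a (2m∸a≤3b le)))
  where
  2m∸a≤3b : LeHalfSqrt5 a b m → 2 * m ∸ a ≤ 3 * b
  2m∸a≤3b (linear 2m≤a) = ≤-trans (≤-reflexive (m≤n⇒m∸n≡0 2m≤a)) z≤n
  2m∸a≤3b (quadratic sq) = m*m≤n*n⇒m≤n (begin
    (2 * m ∸ a) * (2 * m ∸ a) ≤⟨ sq ⟩
    5 * (b * b)               ≤⟨ *-monoˡ-≤ (b * b) (m≤m+n 5 4) ⟩
    9 * (b * b)               ≡⟨ solve (b ∷ []) ⟩
    3 * b * (3 * b)           ∎)
    where open ≤-Reasoning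

indicator-T : ∀ {b} → T b → (if b then 1 else 0) ≡ 1
indicator-T {true} _ = refl

indicator-¬T : ∀ {b} → ¬ T b → (if b then 1 else 0) ≡ 0
indicator-¬T {false} _ = refl
indicator-¬T {true} ¬t = contradiction _ ¬t

count-true : ∀ (p : ℕ → Bool) N → (∀ {j} → 1 ≤ j → j ≤ N → T (p j)) → count N p ≡ N
count-true p zero _ = refl
count-true p (suc N) all = begin
  count N p + (if p (suc N) then 1 else 0) ≡⟨ cong₂ _+_ (count-true p N (λ 1≤j j≤N → all 1≤j (m≤n⇒m≤1+n j≤N)))
                                                          (indicator-T (all (s≤s z≤n) ≤-refl)) ⟩
  N + 1                                     ≡⟨ +-comm N 1 ⟩
  suc N                                     ∎
  where open ≡-Reasoning

count-false-above : ∀ (p : ℕ → Bool) {m} N → m ≤ N → (∀ {j} → m < j → j ≤ N → ¬ T (p j)) →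
                    count N p ≡ count m p
count-false-above p zero z≤n _ = refl
count-false-above p {m} (suc N) m≤1+N none with m≤n⇒m<n∨m≡n m≤1+N
... | inj₂ refl = refl
... | inj₁ m<1+N = begin
  count N p + (if p (suc N) then 1 else 0)
    ≡⟨ cong₂ _+_ (count-false-above p N (≤-pred m<1+N) (λ m<j j≤N → none m<j (m≤n⇒m≤1+n j≤N)))
                 (indicator-¬T (none m<1+N ≤-refl)) ⟩
  count m p + 0                             ≡⟨ +-identityʳ _ ⟩
  count m p                                 ∎
  where open ≡-Reasoning

floorHalfSqrt5-≡ : ∀ {a b m} → LeHalfSqrt5 a b m → ¬ LeHalfSqrt5 a b (suc m) → floorHalfSqrt5 a b ≡ m
floorHalfSqrt5-≡ {a} {b} {m} le ¬le = begin
  count (a + 3 * b + 1) (leHalfSqrt5 a b) ≡⟨ count-false-above _ {m} _ (m≤n⇒m≤n+o 1 (LeHalfSqrt5⇒≤ le))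
                                               (λ {j} m<j _ → ¬le ∘ LeHalfSqrt5-anti m<j ∘ to (T-leHalfSqrt5 a b j)) ⟩
  count m (leHalfSqrt5 a b)               ≡⟨ count-true _ m (λ {j} _ j≤m →
                                               from (T-leHalfSqrt5 a b j) (LeHalfSqrt5-anti j≤m le)) ⟩
  m                                       ∎
  where open ≡-Reasoning

LeHalfSqrt5-shift : ∀ c a b m → LeHalfSqrt5 (2 * c + a) b (c + m) ⇔ LeHalfSqrt5 a b m
LeHalfSqrt5-shift c a b m = mk⇔ unshift shift
  where
  2[c+m] : 2 * (c + m) ≡ 2 * c + 2 * m
  2[c+m] = *-distribˡ-+ 2 c m
  gap : 2 * (c + m) ∸ (2 * c + a) ≡ 2 * m ∸ a
  gap = trans (cong (_∸ (2 * c + a)) 2[c+m]) ([m+n]∸[m+o]≡n∸o (2 * c) (2 * m) a)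
  unshift : LeHalfSqrt5 (2 * c + a) b (c + m) → LeHalfSqrt5 a b m
  unshift (linear le) = linear (+-cancelˡ-≤ (2 * c) _ _ (subst (_≤ 2 * c + a) 2[c+m] le))
  unshift (quadratic le) = quadratic (subst (λ s → s * s ≤ 5 * (b * b)) gap le)
  shift : LeHalfSqrt5 a b m → LeHalfSqrt5 (2 * c + a) b (c + m)
  shift (linear le) = linear (subst (_≤ 2 * c + a) (sym 2[c+m]) (+-monoʳ-≤ (2 * c) le))
  shift (quadratic le) = quadratic (subst (λ s → s * s ≤ 5 * (b * b)) (sym gap) le)

LeHalfSqrt5-approx : ∀ {a b m d e} → 0 < d → e * e ≤ 5 * (d * d) → (2 * m ∸ a) * d ≤ b * e → LeHalfSqrt5 a b m
LeHalfSqrt5-approx {a} {b} {m} {d} {e} 0<d e²≤5d² sd≤be =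
  quadratic (*-cancelʳ-≤ (s * s) (5 * (b * b)) (d * d) {{>-nonZero (*-mono-< 0<d 0<d)}} (begin
    s * s * (d * d) ≡⟨ interchange s s d d ⟩
    s * d * (s * d) ≤⟨ *-mono-≤ sd≤be sd≤be ⟩
    b * e * (b * e) ≡⟨ solve (b ∷ e ∷ []) ⟩
    b * b * (e * e) ≤⟨ *-monoʳ-≤ (b * b) e²≤5d² ⟩
    b * b * (5 * (d * d)) ≡⟨ solve (b ∷ d ∷ []) ⟩
    5 * (b * b) * (d * d) ∎))
  where
  open ≤-Reasoning
  s : ℕ
  s = 2 * m ∸ a

¬LeHalfSqrt5-approx : ∀ {a b m d e} → 5 * (d * d) ≤ e * e → a < 2 * m → b * e < (2 * m ∸ a) * d → ¬ LeHalfSqrt5 a b m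
¬LeHalfSqrt5-approx _ a<2m _ (linear 2m≤a) = <⇒≱ a<2m 2m≤a
¬LeHalfSqrt5-approx {a} {b} {m} {d} {e} 5d²≤e² _ be<sd (quadratic s²≤5b²) = <-irrefl refl (begin-strict
    s * d * (s * d) ≡⟨ interchange s d s d ⟩
    s * s * (d * d) ≤⟨ *-monoˡ-≤ (d * d) s²≤5b² ⟩
    5 * (b * b) * (d * d) ≡⟨ solve (b ∷ d ∷ []) ⟩
    b * b * (5 * (d * d)) ≤⟨ *-monoʳ-≤ (b * b) 5d²≤e² ⟩
    b * b * (e * e) ≡⟨ solve (b ∷ e ∷ []) ⟩
    b * e * (b * e) <⟨ *-mono-< be<sd be<sd ⟩
    s * d * (s * d) ∎)
  where
  open ≤-Reasoning
  s : ℕ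
  s = 2 * m ∸ a

division-complement : ∀ {n y q x r t s} → n * y ≡ q * x + r → n ≤ x → t + suc q ≡ y → s + r ≡ x →
                      (x ∸ n) * y ≡ t * x + s
division-complement {n} {y} {q} {x} {r} {t} {s} ny≡qx+r n≤x t+1+q≡y s+r≡x = +-cancelʳ-≡ (n * y) _ _ (begin
  (x ∸ n) * y + n * y     ≡⟨ sym (*-distribʳ-+ y (x ∸ n) n) ⟩
  (x ∸ n + n) * y         ≡⟨ cong (_* y) (m∸n+n≡m n≤x) ⟩
  x * y                   ≡⟨ cong (x *_) (sym t+1+q≡y) ⟩
  x * (t + suc q)         ≡⟨ solve (x ∷ t ∷ q ∷ []) ⟩
  t * x + q * x + x       ≡⟨ cong (t * x + q * x +_) (sym s+r≡x) ⟩
  t * x + q * x + (s + r) ≡⟨ solve (t ∷ x ∷ q ∷ s ∷ r ∷ []) ⟩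
  t * x + s + (q * x + r) ≡⟨ cong (t * x + s +_) (sym ny≡qx+r) ⟩
  t * x + s + n * y       ∎)
  where open ≡-Reasoning

-- y² − x y − x² = d − c, with no subtraction
CassiniRel : ℕ → ℕ → ℕ → ℕ → Set
CassiniRel c d x y = y * y + c ≡ x * y + x * x + d

module CassiniPair {x y : ℕ} (cassini : CassiniRel 0 1 x y) where

  y²≡xy+x²+1 : y * y ≡ x * y + x * x + 1
  y²≡xy+x²+1 = trans (sym (+-identityʳ (y * y))) cassini

  x≤y : x ≤ y
  x≤y = m*m≤n*n⇒m≤n (≤-trans (≤-trans (m≤n+m (x * x) (x * y)) (m≤m+n _ 1)) (≤-reflexive (sym y²≡xy+x²+1)))

  [2x+y]²+4≡5y² : (2 * x + y) * (2 * x + y) + 4 ≡ 5 * (y * y)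
  [2x+y]²+4≡5y² = begin
    (2 * x + y) * (2 * x + y) + 4   ≡⟨ solve (x ∷ y ∷ []) ⟩
    y * y + 4 * (x * y + x * x + 1) ≡⟨ cong (λ t → y * y + 4 * t) (sym y²≡xy+x²+1) ⟩
    y * y + 4 * (y * y)             ≡⟨ solve (y ∷ []) ⟩
    5 * (y * y)                     ∎
    where open ≡-Reasoning

  [2y∸x]²≡5x²+4 : (2 * y ∸ x) * (2 * y ∸ x) ≡ 5 * (x * x) + 4
  [2y∸x]²≡5x²+4 = square (m∸n+n≡m (≤-trans x≤y (m≤m+n y (y + 0))))
    where
    open ≡-Reasoning
    square : ∀ {c} → c + x ≡ 2 * y → c * c ≡ 5 * (x * x) + 4
    square {c} c+x≡2y = +-cancelʳ-≡ (4 * (x * y)) _ _ (begin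
      c * c + 4 * (x * y)              ≡⟨ solve (c ∷ x ∷ y ∷ []) ⟩
      c * c + 2 * x * (2 * y)          ≡⟨ cong (λ t → c * c + 2 * x * t) (sym c+x≡2y) ⟩
      c * c + 2 * x * (c + x)          ≡⟨ solve (c ∷ x ∷ []) ⟩
      (c + x) * (c + x) + x * x        ≡⟨ cong (λ t → t * t + x * x) c+x≡2y ⟩
      2 * y * (2 * y) + x * x          ≡⟨ solve (x ∷ y ∷ []) ⟩
      4 * (y * y) + x * x              ≡⟨ cong (λ t → 4 * t + x * x) y²≡xy+x²+1 ⟩
      4 * (x * y + x * x + 1) + x * x  ≡⟨ solve (x ∷ y ∷ []) ⟩
      5 * (x * x) + 4 + 4 * (x * y)    ∎)

  coprime : Coprime x y
  coprime {d} (d∣x , d∣y) = ∣1⇒≡1 (∣m+n∣m⇒∣n (subst (d ∣_) y²≡xy+x²+1 (∣m⇒∣m*n y d∣y))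
    (∣m∣n⇒∣m+n (∣m⇒∣m*n y d∣x) (∣m⇒∣m*n x d∣x)))

  -- The rational bounds (2x + y) / y < √5 < (2y − x) / x, both consequences of Cassini, give q = ⌊φ n⌋.
  module Quotient {n q r : ℕ} (n<x : n < x) (ny≡qx+r : n * y ≡ q * x + r) (r<x : r < x) where

    qx≤ny : q * x ≤ n * y
    qx≤ny = ≤-trans (m≤m+n (q * x) r) (≤-reflexive (sym ny≡qx+r))

    ny<[1+q]x : n * y < suc q * x
    ny<[1+q]x = begin-strict
      n * y     ≡⟨ ny≡qx+r ⟩
      q * x + r <⟨ +-monoʳ-< (q * x) r<x ⟩
      q * x + x ≡⟨ +-comm (q * x) x ⟩
      suc q * x ∎
      where open ≤-Reasoning

    -- otherwise q y is an integer in (n (x + y), n y² / x] = (n (x + y), n (x + y) + n / x]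
    qy≤n[x+y] : q * y ≤ n * (x + y)
    qy≤n[x+y] = ≮⇒≥ λ n[x+y]<qy → <⇒≱ n<x (+-cancelˡ-≤ (x * (n * (x + y))) x n (begin
      x * (n * (x + y)) + x      ≡⟨ +-comm _ x ⟩
      x + x * (n * (x + y))      ≡⟨ sym (*-suc x _) ⟩
      x * suc (n * (x + y))      ≤⟨ *-monoʳ-≤ x n[x+y]<qy ⟩
      x * (q * y)                ≡⟨ solve (x ∷ q ∷ y ∷ []) ⟩
      q * x * y                  ≤⟨ *-monoˡ-≤ y qx≤ny ⟩
      n * y * y                  ≡⟨ *-assoc n y y ⟩
      n * (y * y)                ≡⟨ cong (n *_) y²≡xy+x²+1 ⟩
      n * (x * y + x * x + 1)    ≡⟨ solve (n ∷ x ∷ y ∷ []) ⟩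
      x * (n * (x + y)) + n      ∎))
      where open ≤-Reasoning

    q≤φn : LeHalfSqrt5 n n q
    q≤φn = LeHalfSqrt5-approx (<-≤-trans (≤-<-trans z≤n n<x) x≤y)
      (≤-trans (m≤m+n _ 4) (≤-reflexive [2x+y]²+4≡5y²)) (begin
        (2 * q ∸ n) * y             ≡⟨ *-distribʳ-∸ y (2 * q) n ⟩
        2 * q * y ∸ n * y           ≡⟨ cong (_∸ n * y) (*-assoc 2 q y) ⟩
        2 * (q * y) ∸ n * y         ≤⟨ ∸-monoˡ-≤ (n * y) (*-monoʳ-≤ 2 qy≤n[x+y]) ⟩
        2 * (n * (x + y)) ∸ n * y   ≡⟨ cong (_∸ n * y) (solve (n ∷ x ∷ y ∷ [])) ⟩
        n * (2 * x + y) + n * y ∸ n * y ≡⟨ m+n∸n≡m _ (n * y) ⟩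
        n * (2 * x + y)             ∎)
      where open ≤-Reasoning

    φn<1+q : ¬ LeHalfSqrt5 n n (suc q)
    φn<1+q = ¬LeHalfSqrt5-approx
      (≤-trans (m≤m+n _ 4) (≤-reflexive (sym [2y∸x]²≡5x²+4))) n<2[1+q] (begin-strict
        n * (2 * y ∸ x)             ≡⟨ *-distribˡ-∸ n (2 * y) x ⟩
        n * (2 * y) ∸ n * x         <⟨ ∸-monoˡ-< 2ny<2[1+q]x (*-monoʳ-≤ n (≤-trans x≤y (m≤m+n y (y + 0)))) ⟩
        2 * suc q * x ∸ n * x       ≡⟨ sym (*-distribʳ-∸ x (2 * suc q) n) ⟩
        (2 * suc q ∸ n) * x         ∎)
      where
      open ≤-Reasoning
      n<2[1+q] : n < 2 * suc q
      n<2[1+q] = <-≤-trans (*-cancelʳ-< x n (suc q) (≤-<-trans (*-monoʳ-≤ n x≤y) ny<[1+q]x))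
                           (m≤m+n (suc q) (suc q + 0))
      2ny<2[1+q]x : n * (2 * y) < 2 * suc q * x
      2ny<2[1+q]x = begin-strict
        n * (2 * y)     ≡⟨ solve (n ∷ y ∷ []) ⟩
        2 * (n * y)     <⟨ *-monoʳ-< 2 ny<[1+q]x ⟩
        2 * (suc q * x) ≡⟨ sym (*-assoc 2 (suc q) x) ⟩
        2 * suc q * x   ∎

    floorPhi≡q : floorPhi n ≡ q
    floorPhi≡q = floorHalfSqrt5-≡ q≤φn φn<1+q

    floorPhi2≡n+q : floorPhi2 n ≡ n + q
    floorPhi2≡n+q = trans (cong (λ a → floorHalfSqrt5 a n) 3n≡2n+n) (floorHalfSqrt5-≡
      (from (LeHalfSqrt5-shift n n n q) q≤φn)
      (φn<1+q ∘ to (LeHalfSqrt5-shift n n n (suc q)) ∘ subst (LeHalfSqrt5 (2 * n + n) n) (sym (+-suc n q))))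
      where
      3n≡2n+n : 3 * n ≡ 2 * n + n
      3n≡2n+n = solve (n ∷ [])

  module Division {n : ℕ} (n<x : n < x) where

    instance
      x≢0 : NonZero x
      x≢0 = >-nonZero (≤-<-trans z≤n n<x)
      y≢0 : NonZero y
      y≢0 = >-nonZero (<-≤-trans (≤-<-trans z≤n n<x) x≤y)

    q r : ℕ
    q = n * y / x
    r = n * y % x

    ny≡qx+r : n * y ≡ q * x + r
    ny≡qx+r = trans (m≡m%n+[m/n]*n (n * y) x) (+-comm r (q * x))

    r<x : r < x
    r<x = m%n<n (n * y) x

    open Quotient {q = q} n<x ny≡qx+r r<x public

  floorPhi2≡n+floorPhi : ∀ {n} → n < x → floorPhi2 n ≡ n + floorPhi n
  floorPhi2≡n+floorPhi n<x = trans floorPhi2≡n+q (cong (_ +_) (sym floorPhi≡q))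
    where open Division n<x

  floorPhi-complement : ∀ {n} → 0 < n → n < x → floorPhi n + floorPhi (x ∸ n) ≡ pred y
  floorPhi-complement {n} 0<n n<x = begin
    floorPhi n + floorPhi (x ∸ n) ≡⟨ cong₂ _+_ floorPhi≡q
                                            (Quotient.floorPhi≡q {q = y ∸ suc q} x∸n<x complement x∸r<x) ⟩
    q + (y ∸ suc q)               ≡⟨ cong pred (m+[n∸m]≡n q<y) ⟩
    pred y                        ∎
    where
    open ≡-Reasoning
    open Division n<x
    0<r : 0 < r
    0<r = n≢0⇒n>0 λ r≡0 → <⇒≱ n<x (∣⇒≤ {{>-nonZero 0<n}} (coprime-divisor coprime
      (divides q (trans (*-comm y n) (trans ny≡qx+r (trans (cong (q * x +_) r≡0) (+-identityʳ _)))))))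
    q<y : q < y
    q<y = *-cancelʳ-< x q y (≤-<-trans qx≤ny (subst (n * y <_) (*-comm x y) (*-monoˡ-< y n<x)))
    x∸n<x : x ∸ n < x
    x∸n<x = ∸-monoʳ-< 0<n (<⇒≤ n<x)
    x∸r<x : x ∸ r < x
    x∸r<x = ∸-monoʳ-< 0<r (<⇒≤ r<x)
    complement : (x ∸ n) * y ≡ (y ∸ suc q) * x + (x ∸ r)
    complement = division-complement ny≡qx+r (<⇒≤ n<x) (m∸n+n≡m q<y) (m∸n+n≡m (<⇒≤ r<x))

sumFrom1-cong : ∀ N {f g} → (∀ {n} → 1 ≤ n → n ≤ N → f n ≡ g n) → sumFrom1 N f ≡ sumFrom1 N g
sumFrom1-cong zero _ = refl
sumFrom1-cong (suc N) f≗g =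
  cong₂ _+_ (sumFrom1-cong N (λ 1≤n n≤N → f≗g 1≤n (m≤n⇒m≤1+n n≤N))) (f≗g (s≤s z≤n) ≤-refl)

sumFrom1-+ : ∀ N f g → sumFrom1 N (λ n → f n + g n) ≡ sumFrom1 N f + sumFrom1 N g
sumFrom1-+ zero f g = refl
sumFrom1-+ (suc N) f g = trans (cong (_+ (f (suc N) + g (suc N))) (sumFrom1-+ N f g))
  (+-interchange (sumFrom1 N f) (sumFrom1 N g) (f (suc N)) (g (suc N)))

sumFrom1-const : ∀ N c → sumFrom1 N (λ _ → c) ≡ N * c
sumFrom1-const zero c = refl
sumFrom1-const (suc N) c = trans (cong (_+ c) (sumFrom1-const N c)) (+-comm (N * c) c)

2*sumFrom1-id : ∀ N → 2 * sumFrom1 N id ≡ N * suc N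
2*sumFrom1-id zero = refl
2*sumFrom1-id (suc N) = begin
  2 * (sumFrom1 N id + suc N)    ≡⟨ *-distribˡ-+ 2 (sumFrom1 N id) (suc N) ⟩
  2 * sumFrom1 N id + 2 * suc N  ≡⟨ cong (_+ 2 * suc N) (2*sumFrom1-id N) ⟩
  N * suc N + 2 * suc N          ≡⟨ solve (N ∷ []) ⟩
  suc N * suc (suc N)            ∎
  where open ≡-Reasoning

sumFrom1-suc : ∀ N f → sumFrom1 (suc N) f ≡ f 1 + sumFrom1 N (f ∘ suc)
sumFrom1-suc zero f = +-comm 0 (f 1)
sumFrom1-suc (suc N) f = trans (cong (_+ f (2 + N)) (sumFrom1-suc N f)) (+-assoc (f 1) _ _)

sumFrom1-reverse : ∀ N f → sumFrom1 N f ≡ sumFrom1 N (λ n → f (suc N ∸ n))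
sumFrom1-reverse zero f = refl
sumFrom1-reverse (suc N) f = begin
  sumFrom1 N f + f (suc N)                        ≡⟨ cong (_+ f (suc N)) (sumFrom1-reverse N f) ⟩
  sumFrom1 N (λ n → f (suc N ∸ n)) + f (suc N)    ≡⟨ +-comm _ (f (suc N)) ⟩
  f (suc N) + sumFrom1 N (λ n → f (suc N ∸ n))    ≡⟨ sym (sumFrom1-suc N (λ n → f (2 + N ∸ n))) ⟩
  sumFrom1 (suc N) (λ n → f (2 + N ∸ n))          ∎
  where open ≡-Reasoning

module _ {N M : ℕ} (cassini : CassiniRel 0 1 (suc N) (suc M)) where
  open CassiniPair {suc N} {suc M} cassini

  2*sumFrom1-floorPhi : 2 * sumFrom1 N floorPhi ≡ N * M
  2*sumFrom1-floorPhi = begin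
    2 * Σφ                                             ≡⟨ cong (Σφ +_) (+-identityʳ Σφ) ⟩
    Σφ + Σφ                                            ≡⟨ cong (Σφ +_) (sumFrom1-reverse N floorPhi) ⟩
    Σφ + sumFrom1 N (λ n → floorPhi (suc N ∸ n))       ≡⟨ sym (sumFrom1-+ N floorPhi _) ⟩
    sumFrom1 N (λ n → floorPhi n + floorPhi (suc N ∸ n))
      ≡⟨ sumFrom1-cong N (λ 1≤n n≤N → floorPhi-complement 1≤n (s≤s n≤N)) ⟩
    sumFrom1 N (λ _ → M)                               ≡⟨ sumFrom1-const N M ⟩
    N * M                                              ∎
    where
    open ≡-Reasoning
    Σφ : ℕ
    Σφ = sumFrom1 N floorPhi

  2*sumFrom1-floorPhi2 : 2 * sumFrom1 N floorPhi2 ≡ N * (suc N + M)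
  2*sumFrom1-floorPhi2 = begin
    2 * sumFrom1 N floorPhi2
      ≡⟨ cong (2 *_) (sumFrom1-cong N (λ _ n≤N → floorPhi2≡n+floorPhi (s≤s n≤N))) ⟩
    2 * sumFrom1 N (λ n → n + floorPhi n)           ≡⟨ cong (2 *_) (sumFrom1-+ N id floorPhi) ⟩
    2 * (sumFrom1 N id + sumFrom1 N floorPhi)       ≡⟨ *-distribˡ-+ 2 (sumFrom1 N id) _ ⟩
    2 * sumFrom1 N id + 2 * sumFrom1 N floorPhi     ≡⟨ cong₂ _+_ (2*sumFrom1-id N) 2*sumFrom1-floorPhi ⟩
    N * suc N + N * M                               ≡⟨ sym (*-distribˡ-+ N (suc N) M) ⟩
    N * (suc N + M)                                 ∎
    where open ≡-Reasoning

F-+ : ∀ m n → F (suc (m + n)) ≡ F (suc m) * F (suc n) + F m * F n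
F-+ zero n = sym (trans (+-identityʳ (F (suc n) + 0)) (+-identityʳ (F (suc n))))
F-+ (suc zero) n = sym (cong₂ _+_ (+-identityʳ (F (suc n))) (+-identityʳ (F n)))
F-+ (suc (suc m)) n = begin
  F (suc (suc m + n)) + F (suc (m + n))                                   ≡⟨ cong₂ _+_ (F-+ (suc m) n) (F-+ m n) ⟩
  F (2 + m) * F (suc n) + F (suc m) * F n + (F (suc m) * F (suc n) + F m * F n)
    ≡⟨ +-interchange (F (2 + m) * F (suc n)) _ _ _ ⟩
  F (2 + m) * F (suc n) + F (suc m) * F (suc n) + (F (suc m) * F n + F m * F n)
    ≡⟨ sym (cong₂ _+_ (*-distribʳ-+ (F (suc n)) (F (2 + m)) _) (*-distribʳ-+ (F n) (F (suc m)) _)) ⟩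
  F (3 + m) * F (suc n) + F (2 + m) * F n                                  ∎
  where open ≡-Reasoning

L≡F+F : ∀ n → L (suc n) ≡ F n + F (2 + n)
L≡F+F zero = refl
L≡F+F (suc zero) = refl
L≡F+F (suc (suc n)) = trans (cong₂ _+_ (L≡F+F (suc n)) (L≡F+F n))
  (+-interchange (F (suc n)) (F (3 + n)) (F n) (F (2 + n)))

F[2n]≡F[n]*L[n] : ∀ n → F (2 * n) ≡ F n * L n
F[2n]≡F[n]*L[n] zero = refl
F[2n]≡F[n]*L[n] (suc m) = begin
  F (suc (m + suc (m + 0)))                 ≡⟨ cong (λ t → F (suc (m + suc t))) (+-identityʳ m) ⟩
  F (suc (m + suc m))                       ≡⟨ F-+ m (suc m) ⟩
  F (suc m) * F (2 + m) + F m * F (suc m)   ≡⟨ cong (F (suc m) * F (2 + m) +_) (*-comm (F m) (F (suc m))) ⟩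
  F (suc m) * F (2 + m) + F (suc m) * F m   ≡⟨ sym (*-distribˡ-+ (F (suc m)) (F (2 + m)) (F m)) ⟩
  F (suc m) * (F (2 + m) + F m)             ≡⟨ cong (F (suc m) *_) (trans (+-comm _ (F m)) (sym (L≡F+F m))) ⟩
  F (suc m) * L (suc m)                     ∎
  where open ≡-Reasoning

F[1+2n]≡F[1+n]²+F[n]² : ∀ n → F (suc (2 * n)) ≡ F (suc n) * F (suc n) + F n * F n
F[1+2n]≡F[1+n]²+F[n]² n = trans (cong (λ t → F (suc (n + t))) (+-identityʳ n)) (F-+ n n)

F[2n]+L[n]*F[1+n]≡L[n]*F[2+n] : ∀ n → F (2 * n) + L n * F (suc n) ≡ L n * F (2 + n)
F[2n]+L[n]*F[1+n]≡L[n]*F[2+n] n = begin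
  F (2 * n) + L n * F (suc n)    ≡⟨ cong (_+ L n * F (suc n)) (trans (F[2n]≡F[n]*L[n] n) (*-comm (F n) (L n))) ⟩
  L n * F n + L n * F (suc n)    ≡⟨ sym (*-distribˡ-+ (L n) (F n) (F (suc n))) ⟩
  L n * (F n + F (suc n))        ≡⟨ cong (L n *_) (+-comm (F n) (F (suc n))) ⟩
  L n * F (2 + n)                ∎
  where open ≡-Reasoning

F[2n]+F[n]*L[1+n]≡F[n]*L[2+n] : ∀ n → F (2 * n) + F n * L (suc n) ≡ F n * L (2 + n)
F[2n]+F[n]*L[1+n]≡F[n]*L[2+n] n = begin
  F (2 * n) + F n * L (suc n)    ≡⟨ cong (_+ F n * L (suc n)) (F[2n]≡F[n]*L[n] n) ⟩
  F n * L n + F n * L (suc n)    ≡⟨ sym (*-distribˡ-+ (F n) (L n) (L (suc n))) ⟩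
  F n * (L n + L (suc n))        ≡⟨ cong (F n *_) (+-comm (L n) (L (suc n))) ⟩
  F n * L (2 + n)                ∎
  where open ≡-Reasoning

cassini-step : ∀ {c d} x y → CassiniRel c d x y → CassiniRel d c y (y + x)
cassini-step {c} {d} x y h = +-cancelʳ-≡ (y * y + c) _ _ (begin
  (y + x) * (y + x) + d + (y * y + c)                    ≡⟨ solve (c ∷ d ∷ x ∷ y ∷ []) ⟩
  y * (y + x) + y * y + c + (x * y + x * x + d)          ≡⟨ cong (y * (y + x) + y * y + c +_) (sym h) ⟩
  y * (y + x) + y * y + c + (y * y + c)                  ∎)
  where open ≡-Reasoning

cassini-F : ∀ i → i % 2 ≡ 0 → CassiniRel 0 1 (F i) (F (suc i))
cassini-F zero _ = refl
cassini-F (suc (suc i)) i-even = cassini-step (F (suc i)) (F (2 + i)) (cassini-step (F i) (F (suc i)) (cassini-F i i-even))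

cassini-cancel : ∀ a b {P R} → CassiniRel 0 1 a b → P + (a * b + a * a) ≡ R + b * b → P ≡ suc R
cassini-cancel a b {P} {R} cassini P+ab+a²≡R+b² = +-cancelʳ-≡ (a * b + a * a) P (suc R) (begin
  P + (a * b + a * a)       ≡⟨ P+ab+a²≡R+b² ⟩
  R + b * b                 ≡⟨ cong (R +_) (CassiniPair.y²≡xy+x²+1 {a} {b} cassini) ⟩
  R + (a * b + a * a + 1)   ≡⟨ R+[X+1]≡1+R+X ⟩
  suc R + (a * b + a * a)   ∎)
  where
  open ≡-Reasoning
  R+[X+1]≡1+R+X : R + (a * b + a * a + 1) ≡ suc R + (a * b + a * a)
  R+[X+1]≡1+R+X = trans (cong (R +_) (+-comm _ 1)) (+-suc R _)

consecutive-coprime : ∀ (s : ℕ → ℕ) → (∀ n → s (2 + n) ≡ s (suc n) + s n) → Coprime (s 0) (s 1) →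
                      ∀ n → Coprime (s n) (s (suc n))
consecutive-coprime s rec c₀ zero = c₀
consecutive-coprime s rec c₀ (suc n) =
  subst (Coprime (s (suc n))) (sym (rec n)) (Coprimality.sym (coprime-+ (consecutive-coprime s rec c₀ n)))

F-coprime : ∀ n → Coprime (F n) (F (suc n))
F-coprime = consecutive-coprime F (λ _ → refl) (∣1⇒≡1 ∘ proj₂)

L-coprime : ∀ n → Coprime (L n) (L (suc n))
L-coprime = consecutive-coprime L (λ _ → refl) (∣1⇒≡1 ∘ proj₂)

lcm[cp,cq]≡c[pq] : ∀ c {p q} → Coprime p q → lcm (c * p) (c * q) ≡ c * (p * q)
lcm[cp,cq]≡c[pq] zero _ = refl
lcm[cp,cq]≡c[pq] c@(suc _) {p} {q} p⊥q = *-cancelˡ-≡ _ _ c (begin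
  c * lcm (c * p) (c * q)                    ≡⟨ cong (_* lcm (c * p) (c * q)) (sym gcd≡c) ⟩
  gcd (c * p) (c * q) * lcm (c * p) (c * q)  ≡⟨ gcd*lcm (c * p) (c * q) ⟩
  c * p * (c * q)                            ≡⟨ *-assoc c p (c * q) ⟩
  c * (p * (c * q))                          ≡⟨ cong (c *_) (x∙yz≈y∙xz p c q) ⟩
  c * (c * (p * q))                          ∎)
  where
  open ≡-Reasoning
  gcd≡c : gcd (c * p) (c * q) ≡ c
  gcd≡c = trans (sym (c*gcd[m,n]≡gcd[cm,cn] c p q)) (trans (cong (c *_) (coprime⇒gcd≡1 p⊥q)) (*-identityʳ c))

lcm-halves : ∀ {m n X p q} → 2 * m ≡ X * p → 2 * n ≡ X * q → Coprime p q → lcm m n ≡ X * (p * q) / 2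
lcm-halves {m} {n} {X} {p} {q} 2m≡Xp 2n≡Xq p⊥q with 2∣X
  where
  2∣X : 2 ∣ X
  2∣X with euclidsLemma X p prime[2] (divides m (trans (sym 2m≡Xp) (*-comm 2 m)))
          | euclidsLemma X q prime[2] (divides n (trans (sym 2n≡Xq) (*-comm 2 n)))
  ... | inj₁ 2∣X | _ = 2∣X
  ... | inj₂ _ | inj₁ 2∣X = 2∣X
  ... | inj₂ 2∣p | inj₂ 2∣q = contradiction (p⊥q (2∣p , 2∣q)) λ ()
... | divides Y refl = begin
  lcm m n                    ≡⟨ cong₂ lcm (halve {m} 2m≡Xp) (halve {n} 2n≡Xq) ⟩
  lcm (Y * p) (Y * q)        ≡⟨ lcm[cp,cq]≡c[pq] Y p⊥q ⟩
  Y * (p * q)                ≡⟨ sym (m*n/n≡m (Y * (p * q)) 2) ⟩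
  Y * (p * q) * 2 / 2        ≡⟨ cong (_/ 2) rearrange ⟩
  Y * 2 * (p * q) / 2        ∎
  where
  open ≡-Reasoning
  rearrange : Y * (p * q) * 2 ≡ Y * 2 * (p * q)
  rearrange = solve (Y ∷ p ∷ q ∷ [])
  halve : ∀ {k r} → 2 * k ≡ Y * 2 * r → k ≡ Y * r
  halve {k} {r} 2k≡2Yr = *-cancelˡ-≡ k (Y * r) 2 (trans 2k≡2Yr (solve (Y ∷ r ∷ [])))

lcm-A-A' : ∀ k {N c p q} → F (2 * k) ≡ suc N → F (suc (2 * k)) ≡ suc (c * p) → F (2 * k) + c * p ≡ c * q →
           Coprime p q → lcm (A (2 * k)) (A' (2 * k)) ≡ N * c * (p * q) / 2
lcm-A-A' k {N} {c} {p} {q} F[2k]≡1+N F[1+2k]≡1+cp F[2k]+cp≡cq p⊥q = lcm-halves {A (2 * k)} {A' (2 * k)} {N * c}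
  (begin
    2 * sumFrom1 (F (2 * k) ∸ 1) floorPhi ≡⟨ cong (λ x → 2 * sumFrom1 (x ∸ 1) floorPhi) F[2k]≡1+N ⟩
    2 * sumFrom1 N floorPhi                 ≡⟨ 2*sumFrom1-floorPhi {N} {c * p} cassini ⟩
    N * (c * p)                             ≡⟨ sym (*-assoc N c p) ⟩
    N * c * p                               ∎)
  (begin
    2 * sumFrom1 (F (2 * k) ∸ 1) floorPhi2 ≡⟨ cong (λ x → 2 * sumFrom1 (x ∸ 1) floorPhi2) F[2k]≡1+N ⟩
    2 * sumFrom1 N floorPhi2                 ≡⟨ 2*sumFrom1-floorPhi2 {N} {c * p} cassini ⟩
    N * (suc N + c * p)                      ≡⟨ cong (λ x → N * (x + c * p)) (sym F[2k]≡1+N) ⟩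
    N * (F (2 * k) + c * p)                  ≡⟨ cong (N *_) F[2k]+cp≡cq ⟩
    N * (c * q)                              ≡⟨ sym (*-assoc N c q) ⟩
    N * c * q                                ∎)
  p⊥q
  where
  open ≡-Reasoning
  cassini : CassiniRel 0 1 (suc N) (suc (c * p))
  cassini = subst₂ (CassiniRel 0 1) F[2k]≡1+N F[1+2k]≡1+cp
    (cassini-F (2 * k) (trans (cong (_% 2) (*-comm 2 k)) (m*n%n≡0 k 2)))

-- With a = F i and b = F (1 + i) both sides are quadratic forms in a and b whose difference is
-- b² − a b − a², which is 1 by Cassini since i is even.
module _ (i : ℕ) (i-even : i % 2 ≡ 0) where
  open ≡-Reasoning

  cassini : CassiniRel 0 1 (F i) (F (suc i))
  cassini = cassini-F i i-even

  F[2+2i]≡1+F[i]*L[2+i] : F (2 * suc i) ≡ suc (F i * L (2 + i))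
  F[2+2i]≡1+F[i]*L[2+i] = begin
    F (2 * suc i)                        ≡⟨ F[2n]≡F[n]*L[n] (suc i) ⟩
    F (suc i) * L (suc i)                ≡⟨ cong (F (suc i) *_) (L≡F+F i) ⟩
    F (suc i) * (F i + F (2 + i))        ≡⟨ cassini-cancel (F i) (F (suc i)) cassini (identity (F i) (F (suc i))) ⟩
    suc (F i * (F (suc i) + F (3 + i)))  ≡⟨ cong (λ t → suc (F i * t)) (sym (L≡F+F (suc i))) ⟩
    suc (F i * L (2 + i))                ∎
    where
    identity : ∀ a b → b * (a + (b + a)) + (a * b + a * a) ≡ a * (b + ((b + a) + b)) + b * b
    identity = solve-∀

  F[3+2i]≡1+L[1+i]*F[2+i] : F (suc (2 * suc i)) ≡ suc (L (suc i) * F (2 + i))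
  F[3+2i]≡1+L[1+i]*F[2+i] = begin
    F (suc (2 * suc i))                          ≡⟨ F[1+2n]≡F[1+n]²+F[n]² (suc i) ⟩
    F (2 + i) * F (2 + i) + F (suc i) * F (suc i) ≡⟨ cassini-cancel (F i) (F (suc i)) cassini (identity (F i) (F (suc i))) ⟩
    suc ((F i + F (2 + i)) * F (2 + i))          ≡⟨ cong (λ t → suc (t * F (2 + i))) (sym (L≡F+F i)) ⟩
    suc (L (suc i) * F (2 + i))                  ∎
    where
    identity : ∀ a b → (b + a) * (b + a) + b * b + (a * b + a * a) ≡ (a + (b + a)) * (b + a) + b * b
    identity = solve-∀

  F[4+2i]≡1+F[3+i]*L[1+i] : F (2 * (2 + i)) ≡ suc (F (3 + i) * L (suc i))
  F[4+2i]≡1+F[3+i]*L[1+i] = begin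
    F (2 * (2 + i))                            ≡⟨ F[2n]≡F[n]*L[n] (2 + i) ⟩
    F (2 + i) * L (2 + i)                      ≡⟨ cong (F (2 + i) *_) (L≡F+F (suc i)) ⟩
    F (2 + i) * (F (suc i) + F (3 + i))        ≡⟨ cassini-cancel (F i) (F (suc i)) cassini (identity (F i) (F (suc i))) ⟩
    suc (F (3 + i) * (F i + F (2 + i)))        ≡⟨ cong (λ t → suc (F (3 + i) * t)) (sym (L≡F+F i)) ⟩
    suc (F (3 + i) * L (suc i))                ∎
    where
    identity : ∀ a b → (b + a) * (b + ((b + a) + b)) + (a * b + a * a) ≡ ((b + a) + b) * (a + (b + a)) + b * b
    identity = solve-∀

  F[5+2i]≡1+F[2+i]*L[3+i] : F (suc (2 * (2 + i))) ≡ suc (F (2 + i) * L (3 + i))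
  F[5+2i]≡1+F[2+i]*L[3+i] = begin
    F (suc (2 * (2 + i)))                          ≡⟨ F[1+2n]≡F[1+n]²+F[n]² (2 + i) ⟩
    F (3 + i) * F (3 + i) + F (2 + i) * F (2 + i)  ≡⟨ cassini-cancel (F i) (F (suc i)) cassini (identity (F i) (F (suc i))) ⟩
    suc (F (2 + i) * (F (2 + i) + F (4 + i)))      ≡⟨ cong (λ t → suc (F (2 + i) * t)) (sym (L≡F+F (2 + i))) ⟩
    suc (F (2 + i) * L (3 + i))                    ∎
    where
    identity : ∀ a b → ((b + a) + b) * ((b + a) + b) + (b + a) * (b + a) + (a * b + a * a)
                       ≡ (b + a) * ((b + a) + (((b + a) + b) + (b + a))) + b * b
    identity = solve-∀

[1+i]%2≡1⇒i%2≡0 : ∀ i → suc i % 2 ≡ 1 → i % 2 ≡ 0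
[1+i]%2≡1⇒i%2≡0 zero _ = refl
[1+i]%2≡1⇒i%2≡0 (suc (suc i)) = [1+i]%2≡1⇒i%2≡0 i

lcm-A-A'-odd : ∀ i → suc i % 2 ≡ 1 →
  lcm (A (2 * suc i)) (A' (2 * suc i)) ≡ (F (3 + i) * F (2 + i) * F i * L (2 + i) * L (suc i)) / 2
lcm-A-A'-odd i k-odd = trans
  (lcm-A-A' (suc i) (F[2+2i]≡1+F[i]*L[2+i] i i-even) (F[3+2i]≡1+L[1+i]*F[2+i] i i-even)
    (F[2n]+L[n]*F[1+n]≡L[n]*F[2+n] (suc i)) (F-coprime (2 + i)))
  (cong (_/ 2) (rearrange (F i) (L (2 + i)) (L (suc i)) (F (2 + i)) (F (3 + i))))
  where
  i-even : i % 2 ≡ 0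
  i-even = [1+i]%2≡1⇒i%2≡0 i k-odd
  rearrange : ∀ a b c d e → a * b * c * (d * e) ≡ e * d * a * b * c
  rearrange = solve-∀

lcm-A-A'-even : ∀ i → suc i % 2 ≡ 0 →
  lcm (A (2 * suc i)) (A' (2 * suc i)) ≡ (F (2 + i) * F (suc i) * L (3 + i) * L (2 + i) * L i) / 2
lcm-A-A'-even (suc i) i-even = trans
  (lcm-A-A' (2 + i) (F[4+2i]≡1+F[3+i]*L[1+i] i i-even) (F[5+2i]≡1+F[2+i]*L[3+i] i i-even)
    (F[2n]+F[n]*L[1+n]≡F[n]*L[2+n] (2 + i)) (L-coprime (3 + i)))
  (cong (_/ 2) (rearrange (F (3 + i)) (L (suc i)) (F (2 + i)) (L (3 + i)) (L (4 + i))))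
  where
  rearrange : ∀ a b c d e → a * b * c * (d * e) ≡ a * c * e * d * b
  rearrange = solve-∀

theorem5 : (k : ℕ) → 1 ≤ k →
    (k % 2 ≡ 0 → lcm (A (2 * k)) (A' (2 * k)) ≡ (F (k + 1) * F k * L (k + 2) * L (k + 1) * L (k ∸ 1)) / 2)
    × (k % 2 ≡ 1 → lcm (A (2 * k)) (A' (2 * k)) ≡ (F (k + 2) * F (k + 1) * F (k ∸ 1) * L (k + 1) * L k) / 2)
theorem5 (suc i) _ rewrite +-comm i 1 | +-comm i 2 = lcm-A-A'-even i , lcm-A-A'-odd i
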